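{- Let $k$ be a positive integer, let $H$ be a graph with $|V(H)|\ge k$, and let $G$ be a non-trivial graph (i.e. with at least two vertices). Then \[\gamma_{rk}(G\circ H)\le \min\{\,k|A|+\gamma_{rk}(H)\,|B| \;:\; (A,B) \text{ is a dominating couple of } G\,\}.\]
   Context: All graphs are finite and simple. For a positive integer $k$, a $k$-rainbow dominating function of a graph $X$ is a map $f\colon V(X)\to 2^{\{1,\dots,k\}}$ such that for every vertex $v$ with $f(v)=\emptyset$ we have $\bigcup_{u\in N(v)} f(u)=\{1,\dots,k\}$, where $N(v)$ is the open neighborhood of $v$. Its weight is $\|f\|=\sum_{v}|f(v)|$, and $\gamma_{rk}(X)$ is the minimum weight of a $k$-rainbow dominating function of $X$. The lexicographic product $G\circ H$ has vertex set $V(G)\times V(H)$, with $(g_1,h_1)$ adjacent to $(g_2,h_2)$ iff $g_1g_2\in E(G)$, or $g_1=g_2$ and $h_1h_2\in E(H)$. An ordered pair $(A,B)$ of disjoint subsets $A,B\subseteq V(G)$ is a dominating couple of $G$ if for every vertex $x\in V(G)\setminus B$ there is a vertex $w\in A\cup B$ with $x\in N_G(w)$. -}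

module Defs where

open import Data.Nat using (ℕ; zero; suc; _+_; _*_; _≤_)
open import Data.Fin using (Fin; zero; suc)
open import Data.Fin.Base using (remQuot)
open import Data.Fin.Subset using (Subset; _∈_; _∉_; ⊥; ∣_∣)
open import Data.Product using (Σ; ∃; _×_; _,_; proj₁; proj₂)
open import Data.Sum using (_⊎_; inj₁; inj₂)
open import Data.Empty using () renaming (⊥ to Empty)
open import Relation.Nullary using (¬_)
open import Relation.Binary.PropositionalEquality using (_≡_; refl)
import Relation.Binary.PropositionalEquality as Eq

record Graph : Set₁ where
  field
    order : ℕ
    Adj   : Fin order → Fin order → Set
    adj-sym : ∀ {u v} → Adj u v → Adj v u
    irrefl : ∀ {v} → ¬ Adj v v
open Graph public

sumFin : (n : ℕ) → (Fin n → ℕ) → ℕ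
sumFin zero    f = 0
sumFin (suc n) f = f zero + sumFin n (λ i → f (suc i))

-- Lexicographic product G ∘ H; vertex v of Fin (|G| * |H|) encodes
-- the pair remQuot |H| v = (g , h).
lexAdj : (G H : Graph) → Fin (order G * order H) → Fin (order G * order H) → Set
lexAdj G H v w =
  let (g₁ , h₁) = remQuot (order H) v
      (g₂ , h₂) = remQuot (order H) w
  in Adj G g₁ g₂ ⊎ (g₁ ≡ g₂ × Adj H h₁ h₂)

lex : Graph → Graph → Graph
lex G H = record
  { order = order G * order H
  ; Adj = lexAdj G H
  ; adj-sym = λ { (inj₁ a) → inj₁ (Graph.adj-sym G a)
            ; (inj₂ (e , a)) → inj₂ (Eq.sym e , Graph.adj-sym H a) }
  ; irrefl = λ { (inj₁ a) → Graph.irrefl G a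
               ; (inj₂ (_ , a)) → Graph.irrefl H a }
  }

-- k-rainbow dominating function: labels are subsets of {1..k} ≅ Fin k.
IsRDF : (k : ℕ) (X : Graph) → (Fin (order X) → Subset k) → Set
IsRDF k X f = ∀ v → f v ≡ ⊥ → ∀ (c : Fin k) → ∃ λ u → Adj X u v × c ∈ f u

weight : (k : ℕ) (X : Graph) → (Fin (order X) → Subset k) → ℕ
weight k X f = sumFin (order X) (λ v → ∣ f v ∣)

IsRainbowDominationNumber : (k : ℕ) (X : Graph) → ℕ → Set
IsRainbowDominationNumber k X m =
  (Σ (Fin (order X) → Subset k) λ f → IsRDF k X f × weight k X f ≡ m)
  × (∀ f → IsRDF k X f → m ≤ weight k X f)

IsDominatingCouple : (G : Graph) → Subset (order G) → Subset (order G) → Set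
IsDominatingCouple G A B =
  (∀ x → x ∈ A → x ∉ B)
  × (∀ x → x ∉ B → ∃ λ w → (w ∈ A ⊎ w ∈ B) × Adj G w x)

-- Put one singleton colour class {c} on k distinct vertices in the H-fibre of
-- every vertex of A (weight k, and every colour occurs), and on the H-fibre of
-- every vertex of B a k-rainbow dominating function of H of weight at most
-- γ_rk(H) in which every colour occurs; all other fibres get ∅.  An empty
-- vertex in a B-fibre is rainbow dominated inside its own fibre, and an empty
-- vertex outside B sees a whole fibre over some w ∈ A ∪ B.  Such an H-labelling
-- exists because a minimum one either has an empty vertex, whose neighbours
-- then already carry all colours, or has no empty vertex, and then the
-- labelling by singletons, all colours used, has weight |V(H)| ≤ γ_rk(H).
module Submission where

open import Defs
open import Data.Nat using (ℕ; zero; suc; _+_; _*_; _≤_; z≤n; s≤s)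
open import Data.Nat.Properties
  using (≤-refl; ≤-reflexive; ≤-trans; +-mono-≤; m≤m+n; +-assoc; +-identityʳ; *-identityʳ;
         *-zeroʳ; *-distribˡ-+; +-commutativeSemigroup; m≤n⇒∃[o]m+o≡n; module ≤-Reasoning)
open import Algebra.Properties.CommutativeSemigroup +-commutativeSemigroup using (interchange)
open import Data.Bool using (Bool; true; false) renaming (_≟_ to _≟ᵇ_)
open import Data.Fin using (Fin; zero; suc; _↑ˡ_; _↑ʳ_; splitAt; combine; remQuot)
open import Data.Fin.Properties using (splitAt-↑ˡ; splitAt-↑ʳ; remQuot-combine; any?)
open import Data.Fin.Subset using (Subset; Side; _∈_; ⁅_⁆; ∣_∣) renaming (⊥ to ∅)
open import Data.Fin.Subset.Properties using (_∈?_; x∈⁅x⁆; ∉⊥; ∣⁅x⁆∣≡1; ∣⊥∣≡0)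
open import Data.Vec using ([]; _∷_; lookup)
open import Data.Vec.Properties using ([]=⇒lookup; lookup⇒[]=; ≡-dec)
open import Data.Product using (Σ; ∃; ∃₂; _×_; _,_; proj₁; proj₂; uncurry)
import Data.Product as Product
open import Data.Sum using (_⊎_; inj₁; inj₂; [_,_]′)
open import Data.Empty using (⊥-elim)
open import Function using (_∘_; const)
open import Relation.Nullary using (¬_; yes; no; contradiction)
open import Relation.Binary.PropositionalEquality
  using (_≡_; refl; sym; trans; cong; cong₂; cong-app; subst; module ≡-Reasoning)

sumFin-mono : ∀ n {f g : Fin n → ℕ} → (∀ i → f i ≤ g i) → sumFin n f ≤ sumFin n g
sumFin-mono zero    f≤g = z≤n
sumFin-mono (suc n) f≤g = +-mono-≤ (f≤g zero) (sumFin-mono n (f≤g ∘ suc))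

sumFin-cong : ∀ n {f g : Fin n → ℕ} → (∀ i → f i ≡ g i) → sumFin n f ≡ sumFin n g
sumFin-cong zero    f≗g = refl
sumFin-cong (suc n) f≗g = cong₂ _+_ (f≗g zero) (sumFin-cong n (f≗g ∘ suc))

sumFin-const : ∀ n c → sumFin n (const c) ≡ n * c
sumFin-const zero    c = refl
sumFin-const (suc n) c = cong (c +_) (sumFin-const n c)

sumFin-+ : ∀ n (f g : Fin n → ℕ) → sumFin n (λ i → f i + g i) ≡ sumFin n f + sumFin n g
sumFin-+ zero    f g = refl
sumFin-+ (suc n) f g =
  trans (cong (f zero + g zero +_) (sumFin-+ n (f ∘ suc) (g ∘ suc)))
        (interchange (f zero) (g zero) (sumFin n (f ∘ suc)) (sumFin n (g ∘ suc)))

sumFin-*ˡ : ∀ n c (f : Fin n → ℕ) → sumFin n (λ i → c * f i) ≡ c * sumFin n f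
sumFin-*ˡ zero    c f = sym (*-zeroʳ c)
sumFin-*ˡ (suc n) c f =
  trans (cong (c * f zero +_) (sumFin-*ˡ n c (f ∘ suc))) (sym (*-distribˡ-+ c (f zero) _))

sumFin-↑ : ∀ m n (f : Fin (m + n) → ℕ) →
  sumFin (m + n) f ≡ sumFin m (f ∘ (_↑ˡ n)) + sumFin n (f ∘ (m ↑ʳ_))
sumFin-↑ zero    n f = refl
sumFin-↑ (suc m) n f =
  trans (cong (f zero +_) (sumFin-↑ m n (f ∘ suc))) (sym (+-assoc (f zero) _ _))

sumFin-remQuot : ∀ m n (f : Fin m → Fin n → ℕ) →
  sumFin (m * n) (uncurry f ∘ remQuot n) ≡ sumFin m (λ g → sumFin n (f g))
sumFin-remQuot zero    n f = refl
sumFin-remQuot (suc m) n f = begin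
  sumFin (n + m * n) (uncurry f ∘ remQuot n)
    ≡⟨ sumFin-↑ n (m * n) (uncurry f ∘ remQuot n) ⟩
  sumFin n (uncurry f ∘ remQuot n ∘ (_↑ˡ m * n)) +
  sumFin (m * n) (uncurry f ∘ remQuot n ∘ (n ↑ʳ_))
    ≡⟨ cong₂ _+_ (sumFin-cong n (cong (uncurry f) ∘ remQuot-combine zero))
                 (sumFin-cong (m * n) (cong (uncurry f) ∘ remQuot-↑ʳ)) ⟩
  sumFin n (f zero) + sumFin (m * n) (uncurry (f ∘ suc) ∘ remQuot n)
    ≡⟨ cong (sumFin n (f zero) +_) (sumFin-remQuot m n (f ∘ suc)) ⟩
  sumFin (suc m) (λ g → sumFin n (f g)) ∎
  where
  open ≡-Reasoning
  remQuot-↑ʳ : ∀ j → remQuot {suc m} n (n ↑ʳ j) ≡ Product.map₁ suc (remQuot n j)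
  remQuot-↑ʳ j rewrite splitAt-↑ʳ n (m * n) j = refl

indicator : Bool → ℕ
indicator true  = 1
indicator false = 0

sumFin-indicator : ∀ {n} (p : Subset n) → sumFin n (indicator ∘ lookup p) ≡ ∣ p ∣
sumFin-indicator []          = refl
sumFin-indicator (true  ∷ p) = cong suc (sumFin-indicator p)
sumFin-indicator (false ∷ p) = sumFin-indicator p

p≢∅⇒1≤∣p∣ : ∀ {n} (p : Subset n) → ¬ p ≡ ∅ → 1 ≤ ∣ p ∣
p≢∅⇒1≤∣p∣ []          p≢∅ = contradiction refl p≢∅
p≢∅⇒1≤∣p∣ (true  ∷ p) _   = s≤s z≤n
p≢∅⇒1≤∣p∣ (false ∷ p) p≢∅ = p≢∅⇒1≤∣p∣ p (p≢∅ ∘ cong (false ∷_))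

⁅x⁆≢∅ : ∀ {n} (x : Fin n) → ¬ ⁅ x ⁆ ≡ ∅
⁅x⁆≢∅ x ⁅x⁆≡∅ = ∉⊥ (subst (x ∈_) ⁅x⁆≡∅ (x∈⁅x⁆ x))

UsesAllColours : ∀ {k n} → (Fin n → Subset k) → Set
UsesAllColours f = ∀ c → ∃ λ v → c ∈ f v

spread : ∀ {k r} → Subset k → Fin (k + r) → Subset k
spread {k} pad = [ ⁅_⁆ , const pad ]′ ∘ splitAt k

spread-usesAllColours : ∀ {k r} (pad : Subset k) → UsesAllColours (spread {k} {r} pad)
spread-usesAllColours {k} {r} pad c =
  c ↑ˡ r , subst (λ s → c ∈ [ ⁅_⁆ , const pad ]′ s) (sym (splitAt-↑ˡ k c r)) (x∈⁅x⁆ c)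

spread-nonempty : ∀ {k r} (pad : Subset k) → ¬ pad ≡ ∅ → ∀ v → ¬ spread {k} {r} pad v ≡ ∅
spread-nonempty {k} pad pad≢∅ v with splitAt k v
... | inj₁ i = ⁅x⁆≢∅ i
... | inj₂ _ = pad≢∅

spread-weight : ∀ {k r} (pad : Subset k) → sumFin (k + r) (∣_∣ ∘ spread pad) ≡ k + r * ∣ pad ∣
spread-weight {k} {r} pad = begin
  sumFin (k + r) (∣_∣ ∘ spread pad)
    ≡⟨ sumFin-↑ k r (∣_∣ ∘ spread pad) ⟩
  sumFin k (∣_∣ ∘ spread pad ∘ (_↑ˡ r)) + sumFin r (∣_∣ ∘ spread pad ∘ (k ↑ʳ_))
    ≡⟨ cong₂ _+_ (sumFin-cong k on-left) (sumFin-cong r on-right) ⟩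
  sumFin k (const 1) + sumFin r (const ∣ pad ∣)
    ≡⟨ cong₂ _+_ (trans (sumFin-const k 1) (*-identityʳ k)) (sumFin-const r ∣ pad ∣) ⟩
  k + r * ∣ pad ∣ ∎
  where
  open ≡-Reasoning
  on-left : ∀ i → ∣ spread pad (i ↑ˡ r) ∣ ≡ 1
  on-left i rewrite splitAt-↑ˡ k i r = ∣⁅x⁆∣≡1 i
  on-right : ∀ j → ∣ spread pad (k ↑ʳ j) ∣ ≡ ∣ pad ∣
  on-right j rewrite splitAt-↑ʳ k r j = refl

sparse-labelling : ∀ {k n} → k ≤ n →
  Σ (Fin n → Subset k) λ f → UsesAllColours f × sumFin n (∣_∣ ∘ f) ≤ k
sparse-labelling {k} k≤n with m≤n⇒∃[o]m+o≡n k≤n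
... | r , refl = spread {k} {r} ∅ , spread-usesAllColours ∅ , ≤-reflexive (begin
  sumFin (k + r) (∣_∣ ∘ spread {k} {r} ∅) ≡⟨ spread-weight {k} {r} ∅ ⟩
  k + r * ∣ ∅ {k} ∣              ≡⟨ cong (λ w → k + r * w) (∣⊥∣≡0 k) ⟩
  k + r * 0                      ≡⟨ cong (k +_) (*-zeroʳ r) ⟩
  k + 0                          ≡⟨ +-identityʳ k ⟩
  k                              ∎)
  where open ≡-Reasoning

singleton-labelling : ∀ {k n} → 1 ≤ k → k ≤ n →
  Σ (Fin n → Subset k) λ f → UsesAllColours f × (∀ v → ¬ f v ≡ ∅) × sumFin n (∣_∣ ∘ f) ≡ n
singleton-labelling {suc k} _ k≤n with m≤n⇒∃[o]m+o≡n k≤n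
... | r , refl =
  spread {suc k} {r} ⁅ zero ⁆ ,
  spread-usesAllColours ⁅ zero ⁆ ,
  spread-nonempty {suc k} {r} ⁅ zero ⁆ (⁅x⁆≢∅ zero) ,
  trans (spread-weight {suc k} {r} ⁅ zero ⁆)
        (cong (suc k +_) (trans (cong (r *_) (∣⁅x⁆∣≡1 {suc k} zero)) (*-identityʳ r)))

module _ {k : ℕ} (X : Graph) where

  IsRDF⇒usesAllColours : ∀ {f v} → IsRDF k X f → f v ≡ ∅ → UsesAllColours f
  IsRDF⇒usesAllColours rdf fv≡∅ c with rdf _ fv≡∅ c
  ... | u , _ , c∈fu = u , c∈fu

  nonempty⇒order≤weight : ∀ {f} → (∀ v → ¬ f v ≡ ∅) → order X ≤ weight k X f
  nonempty⇒order≤weight {f} f≢∅ = begin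
    order X                      ≡⟨ sym (*-identityʳ (order X)) ⟩
    order X * 1                  ≡⟨ sym (sumFin-const (order X) 1) ⟩
    sumFin (order X) (const 1)   ≤⟨ sumFin-mono (order X) (λ v → p≢∅⇒1≤∣p∣ (f v) (f≢∅ v)) ⟩
    weight k X f                 ∎
    where open ≤-Reasoning

  allColours-rdf : 1 ≤ k → k ≤ order X → ∀ {f} → IsRDF k X f →
    Σ (Fin (order X) → Subset k) λ g →
      IsRDF k X g × UsesAllColours g × weight k X g ≤ weight k X f
  allColours-rdf 1≤k k≤n {f} rdf with any? (λ v → ≡-dec _≟ᵇ_ (f v) ∅)
  ... | yes (v , fv≡∅) = f , rdf , IsRDF⇒usesAllColours rdf fv≡∅ , ≤-refl
  ... | no ∄v[fv≡∅] with singleton-labelling 1≤k k≤n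
  ...   | g , g-colours , g≢∅ , g-weight =
    g , (λ v gv≡∅ → contradiction gv≡∅ (g≢∅ v)) , g-colours ,
    ≤-trans (≤-reflexive g-weight) (nonempty⇒order≤weight (λ v fv≡∅ → ∄v[fv≡∅] (v , fv≡∅)))

module _ {k : ℕ} (G H : Graph) (F : Fin (order G) → Fin (order H) → Subset k) where

  lexLabelling : Fin (order (lex G H)) → Subset k
  lexLabelling = uncurry F ∘ remQuot {order G} (order H)

  weight-lexLabelling :
    weight k (lex G H) lexLabelling ≡ sumFin (order G) (λ g → sumFin (order H) (∣_∣ ∘ F g))
  weight-lexLabelling = sumFin-remQuot (order G) (order H) (λ g h → ∣ F g h ∣)

  IsLexRDF : Set
  IsLexRDF = ∀ x h → F x h ≡ ∅ → ∀ c →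
    ∃₂ λ g u → (Adj G g x ⊎ (g ≡ x × Adj H u h)) × c ∈ F g u

  IsLexRDF⇒IsRDF : IsLexRDF → IsRDF k (lex G H) lexLabelling
  IsLexRDF⇒IsRDF lexRDF v Fv≡∅ c
    with lexRDF (proj₁ (remQuot {order G} (order H) v)) (proj₂ (remQuot {order G} (order H) v))
                Fv≡∅ c
  ... | g , u , adj , c∈Fgu =
    combine g u , subst (λ (g′ , u′) → lexAdj-to g′ u′ × c ∈ F g′ u′)
                        (sym (remQuot-combine g u)) (adj , c∈Fgu)
    where
    lexAdj-to : Fin (order G) → Fin (order H) → Set
    lexAdj-to g′ u′ =
      let (x , h) = remQuot {order G} (order H) v in Adj G g′ x ⊎ (g′ ≡ x × Adj H u′ h)

fibre : ∀ {k n} → (Fin n → Subset k) → (Fin n → Subset k) → Side → Side → Fin n → Subset k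
fibre PA PB true  _     = PA
fibre PA PB false true  = PB
fibre PA PB false false = const ∅

module _ {k : ℕ} (G H : Graph) (A B : Subset (order G)) (PA PB : Fin (order H) → Subset k)
  where

  coupleLabelling : Fin (order G) → Fin (order H) → Subset k
  coupleLabelling g = fibre PA PB (lookup A g) (lookup B g)

  fibre-weight : ∀ {a b} → sumFin (order H) (∣_∣ ∘ PA) ≤ a → sumFin (order H) (∣_∣ ∘ PB) ≤ b →
    ∀ s t → sumFin (order H) (∣_∣ ∘ fibre PA PB s t) ≤ a * indicator s + b * indicator t
  fibre-weight {a} PA≤a PB≤b true t =
    ≤-trans PA≤a (≤-trans (≤-reflexive (sym (*-identityʳ a))) (m≤m+n (a * 1) _))
  fibre-weight {a} {b} PA≤a PB≤b false true =
    ≤-trans PB≤b (≤-reflexive (sym (cong₂ _+_ (*-zeroʳ a) (*-identityʳ b))))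
  fibre-weight PA≤a PB≤b false false =
    subst (_≤ _) (sym (trans (sumFin-cong (order H) (λ _ → ∣⊥∣≡0 k))
                             (trans (sumFin-const (order H) 0) (*-zeroʳ (order H))))) z≤n

  coupleLabelling-weight : ∀ {a b} →
    sumFin (order H) (∣_∣ ∘ PA) ≤ a → sumFin (order H) (∣_∣ ∘ PB) ≤ b →
    sumFin (order G) (λ g → sumFin (order H) (∣_∣ ∘ coupleLabelling g)) ≤ a * ∣ A ∣ + b * ∣ B ∣
  coupleLabelling-weight {a} {b} PA≤a PB≤b = begin
    sumFin (order G) (λ g → sumFin (order H) (∣_∣ ∘ coupleLabelling g))
      ≤⟨ sumFin-mono (order G) (λ g → fibre-weight PA≤a PB≤b (lookup A g) (lookup B g)) ⟩
    sumFin (order G) (λ g → a * indicator (lookup A g) + b * indicator (lookup B g))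
      ≡⟨ sumFin-+ (order G) _ _ ⟩
    sumFin (order G) (λ g → a * indicator (lookup A g)) +
    sumFin (order G) (λ g → b * indicator (lookup B g))
      ≡⟨ cong₂ _+_ (trans (sumFin-*ˡ (order G) a _) (cong (a *_) (sumFin-indicator A)))
                   (trans (sumFin-*ˡ (order G) b _) (cong (b *_) (sumFin-indicator B))) ⟩
    a * ∣ A ∣ + b * ∣ B ∣ ∎
    where open ≤-Reasoning

  module _ (couple : IsDominatingCouple G A B) where

    coupleLabelling-∈A : ∀ {x} → x ∈ A → coupleLabelling x ≡ PA
    coupleLabelling-∈A x∈A rewrite []=⇒lookup x∈A = refl

    coupleLabelling-∈B : ∀ {x} → x ∈ B → coupleLabelling x ≡ PB
    coupleLabelling-∈B {x} x∈B with lookup A x in eq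
    ... | true  = ⊥-elim (proj₁ couple x (lookup⇒[]= x A eq) x∈B)
    ... | false rewrite []=⇒lookup x∈B = refl

    coupleLabelling-isLexRDF : UsesAllColours PA → UsesAllColours PB → IsRDF k H PB →
      IsLexRDF G H coupleLabelling
    coupleLabelling-isLexRDF PA-colours PB-colours PB-rdf x h Fxh≡∅ c with x ∈? B
    ... | yes x∈B with PB-rdf h (trans (sym (cong-app (coupleLabelling-∈B x∈B) h)) Fxh≡∅) c
    ...   | u , adj , c∈PBu =
      x , u , inj₂ (refl , adj) , subst (c ∈_) (sym (cong-app (coupleLabelling-∈B x∈B) u)) c∈PBu
    coupleLabelling-isLexRDF PA-colours PB-colours PB-rdf x h Fxh≡∅ c
      | no x∉B with proj₂ couple x x∉B
    ...   | w , inj₁ w∈A , adj with PA-colours c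
    ...     | u , c∈PAu =
      w , u , inj₁ adj , subst (c ∈_) (sym (cong-app (coupleLabelling-∈A w∈A) u)) c∈PAu
    coupleLabelling-isLexRDF PA-colours PB-colours PB-rdf x h Fxh≡∅ c
      | no x∉B | w , inj₂ w∈B , adj with PB-colours c
    ...     | u , c∈PBu =
      w , u , inj₁ adj , subst (c ∈_) (sym (cong-app (coupleLabelling-∈B w∈B) u)) c∈PBu

proposition5 : (k : ℕ) → 1 ≤ k → (G H : Graph) → k ≤ order H → 2 ≤ order G →
    (γH γGH : ℕ) → IsRainbowDominationNumber k H γH →
    IsRainbowDominationNumber k (lex G H) γGH →
    (A B : Subset (order G)) → IsDominatingCouple G A B →
    γGH ≤ k * ∣ A ∣ + γH * ∣ B ∣
proposition5 k 1≤k G H k≤|H| _ γH γGH ((f , f-rdf , f-weight) , _) (_ , γGH-minimal) A B couple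
  with sparse-labelling k≤|H| | allColours-rdf H 1≤k k≤|H| f-rdf
... | PA , PA-colours , PA-weight | PB , PB-rdf , PB-colours , PB-weight = begin
  γGH                                          ≤⟨ γGH-minimal (lexLabelling G H F) F-rdf ⟩
  weight k (lex G H) (lexLabelling G H F)      ≡⟨ weight-lexLabelling G H F ⟩
  sumFin (order G) (λ g → sumFin (order H) (∣_∣ ∘ F g))
    ≤⟨ coupleLabelling-weight G H A B PA PB PA-weight (≤-trans PB-weight (≤-reflexive f-weight)) ⟩
  k * ∣ A ∣ + γH * ∣ B ∣                       ∎
  where
  open ≤-Reasoning
  F : Fin (order G) → Fin (order H) → Subset k
  F = coupleLabelling G H A B PA PB
  F-rdf : IsRDF k (lex G H) (lexLabelling G H F)
  F-rdf = IsLexRDF⇒IsRDF G H F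
            (coupleLabelling-isLexRDF G H A B PA PB couple PA-colours PB-colours PB-rdf)
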